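{- Let $(\lambda,\mu,\pi)$ be simplex-like. Then every finite set $P\subseteq\mathbb{N}^3$ with marginals $(\lambda^T,\mu^T,\pi^T)$ satisfies $P_r\subseteq P\subsetneq P_{r+1}$ for some $r\ge1$. In particular, $P$ is a pyramid.
   Context: $\alpha^T=(\alpha^T_0,\alpha^T_1,\dots)$ is the vector of column lengths of a partition $\alpha$ (columns indexed from $0$). For finite $P\subseteq\mathbb{N}^3$, its marginals are $(x_P,y_P,z_P)$ with $x_P(i)$ the number of points with $x$-coordinate $i$, etc. $P$ is a pyramid if $(x,y,z)\in P$ and $0\le x'\le x$, $0\le y'\le y$, $0\le z'\le z$ imply $(x',y',z')\in P$. For $s\ge1$, $P_s=\{(x,y,z)\in\mathbb{N}^3:x+y+z\le s-1\}$ (so $|P_s|=s(s+1)(s+2)/6$) and $b_s=\sum_{v\in P_s}v$. For $n\ge1$ let $r$ be the largest integer with $|P_r|\le n$ and $p(n)=b_r\cdot(1,1,1)+r(n-|P_r|)$. A triple $(\lambda,\mu,\pi)$ with $|\lambda|=|\mu|=|\pi|=n\neq0$ is simplex-like if $\sum_i i\lambda^T_i+\sum_j j\mu^T_j+\sum_k k\pi^T_k=p(n)$. -}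

module Defs where

open import Data.Nat using (ℕ; zero; suc; _+_; _*_; _∸_; _≤_; _<_; _≥_; _≡ᵇ_; _<ᵇ_)
open import Data.Bool using (Bool; true; false; _∧_)
open import Data.Product using (_×_; _,_; ∃; proj₁; proj₂)
open import Data.List using (List; []; _∷_; length; map; upTo; filterᵇ; concatMap)
open import Data.Nat.ListAction using (sum)
open import Data.List.Relation.Unary.All using (All)
open import Data.List.Relation.Unary.Linked using (Linked)
open import Data.List.Relation.Unary.Unique.Propositional using (Unique)
open import Data.List.Membership.Propositional using (_∈_; _∉_)
open import Relation.Binary.PropositionalEquality using (_≡_)

Pt : Set
Pt = ℕ × ℕ × ℕ

xc yc zc : Pt → ℕ
xc (x , _ , _) = x
yc (_ , y , _) = y
zc (_ , _ , z) = z

IsPartition : List ℕ → Set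
IsPartition l = Linked _≥_ l × All (λ a → 1 ≤ a) l

size : List ℕ → ℕ
size = sum

-- column lengths: λᵀ i = #{ j : λ_j > i }   (columns indexed from 0)
colLen : List ℕ → ℕ → ℕ
colLen l i = length (filterᵇ (λ a → i <ᵇ a) l)

-- Σ_i i · λᵀ_i  (terms with i ≥ |λ| vanish, since λᵀ_i = 0 there)
weightT : List ℕ → ℕ
weightT l = sum (map (λ i → i * colLen l i) (upTo (size l)))

-- a finite subset of ℕ³: a duplicate-free list
FinSet : Set
FinSet = List Pt

xMarg yMarg zMarg : FinSet → ℕ → ℕ
xMarg P i = length (filterᵇ (λ v → xc v ≡ᵇ i) P)
yMarg P i = length (filterᵇ (λ v → yc v ≡ᵇ i) P)
zMarg P i = length (filterᵇ (λ v → zc v ≡ᵇ i) P)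

HasMarginals : FinSet → (ℕ → ℕ) → (ℕ → ℕ) → (ℕ → ℕ) → Set
HasMarginals P a b c = (∀ i → xMarg P i ≡ a i) × (∀ i → yMarg P i ≡ b i) × (∀ i → zMarg P i ≡ c i)

InSimplex : ℕ → Pt → Set
InSimplex s (x , y , z) = x + y + z < s

simplexList : ℕ → List Pt
simplexList s =
  filterᵇ (λ v → (xc v + yc v + zc v) <ᵇ s)
    (concatMap (λ x → concatMap (λ y → map (λ z → (x , y , z)) (upTo s)) (upTo s)) (upTo s))

simplexSize : ℕ → ℕ
simplexSize s = length (simplexList s)

-- b_s · (1,1,1) = Σ_{v ∈ P_s} (x+y+z)
bDot : ℕ → ℕ
bDot s = sum (map (λ v → xc v + yc v + zc v) (simplexList s))

IsLargestR : ℕ → ℕ → Set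
IsLargestR n r = simplexSize r ≤ n × (∀ s → simplexSize s ≤ n → s ≤ r)

pVal : ℕ → ℕ → ℕ
pVal n r = bDot r + r * (n ∸ simplexSize r)

SimplexLike : List ℕ → List ℕ → List ℕ → Set
SimplexLike l m p =
  IsPartition l × IsPartition m × IsPartition p ×
  size l ≡ size m × size m ≡ size p × 1 ≤ size l ×
  (∀ r → IsLargestR (size l) r → weightT l + weightT m + weightT p ≡ pVal (size l) r)

_⊆ₛ_ : (Pt → Set) → FinSet → Set
S ⊆ₛ P = ∀ v → S v → v ∈ P

_⊊ₛ_ : FinSet → (Pt → Set) → Set
P ⊊ₛ S = (∀ v → v ∈ P → S v) × ∃ (λ v → S v × v ∉ P)

IsPyramid : FinSet → Set
IsPyramid P = ∀ x y z x' y' z' → (x , y , z) ∈ P → x' ≤ x → y' ≤ y → z' ≤ z → (x' , y' , z') ∈ P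

module Submission where

-- Write deg(x,y,z) = x + y + z and n = |λ| = |μ| = |π|.
--
-- 1. Marginals.  Counting a finite set by the fibres of a coordinate shows that
--    the marginals (λᵀ, μᵀ, πᵀ) force |P| = n and
--      Σ_{v∈P} deg v = Σ i λᵀ_i + Σ j μᵀ_j + Σ k πᵀ_k = p(n) = b_r·(1,1,1) + r(n − |P_r|),
--    where r is the largest integer with |P_r| ≤ n (it exists since s ≤ |P_s|).
-- 2. Exchange argument.  Split P into A = P ∩ P_r and B = P ∖ P_r, and P_r into
--    A and M = P_r ∖ P.  Points of B have degree ≥ r, points of M have degree
--    ≤ r − 1, and |B| = |M| + (n − |P_r|).  Comparing the two sides of the
--    degree identity forces M = ∅ and deg v = r on B, i.e. P_r ⊆ P ⊆ P_{r+1}.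
-- 3. The inclusion P ⊆ P_{r+1} is strict because |P_{r+1}| > n = |P| by the
--    maximality of r, and r ≥ 1 because |P_1| = 1 ≤ n.
-- 4. A set sandwiched between P_r and P_{r+1} is a pyramid: lowering a
--    coordinate of a point either leaves it unchanged or lands in P_r.

open import Defs
open import Data.Bool using (Bool; true; false; T)
open import Data.Empty using (⊥-elim)
open import Data.List using (List; []; _∷_; _++_; length; map; upTo; applyUpTo; filter; filterᵇ; concat; concatMap; cartesianProductWith; cartesianProduct)
open import Data.List.Membership.Propositional using (_∈_; _∉_; find)
open import Data.List.Properties using (map-∘; map-++; map-cong; length-++; length-map; length-upTo; length-filter)
open import Data.List.Relation.Binary.BagAndSetEquality using (∼bag⇒↭)
open import Data.List.Relation.Binary.Permutation.Propositional using (_↭_; prep; ↭-refl; ↭-trans; ↭-sym)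
open import Data.List.Relation.Binary.Permutation.Propositional.Properties using (↭-length; map⁺; shift)
open import Data.List.Relation.Unary.All as All using (All; []; _∷_; all?)
open import Data.List.Relation.Unary.All.Properties using (all-filter; map⁻)
open import Data.List.Relation.Unary.All.Properties.Core using (¬All⇒Any¬)
open import Data.List.Relation.Unary.Unique.Propositional using (Unique)
open import Data.List.Membership.Propositional.Properties.WithK using (unique∧set⇒bag)
import Data.List.Membership.Propositional.Properties as ∈
import Data.List.Relation.Unary.Unique.Propositional.Properties as Unique
open import Data.Nat
open import Data.Nat.ListAction using (sum)
open import Data.Nat.ListAction.Properties using (sum-++; sum-↭)
open import Data.Nat.Properties
open import Algebra.Properties.CommutativeSemigroup +-commutativeSemigroup using (interchange)
open import Data.Product using (_×_; _,_; ∃; proj₁; proj₂)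
import Data.Product.Properties as Product
open import Function using (_∘_; mk⇔)
open import Relation.Binary.Definitions using (DecidableEquality)
open import Relation.Binary.PropositionalEquality
open import Relation.Nullary using (Dec; yes; no)
open import Relation.Nullary.Decidable using (T?)
open import Relation.Unary.Properties using (∁?)

private
  variable
    A : Set

sumBelow : (ℕ → ℕ) → ℕ → ℕ
sumBelow g zero = 0
sumBelow g (suc n) = g 0 + sumBelow (g ∘ suc) n

sumBelow-cong : ∀ {g h} n → (∀ i → g i ≡ h i) → sumBelow g n ≡ sumBelow h n
sumBelow-cong zero e = refl
sumBelow-cong (suc n) e = cong₂ _+_ (e 0) (sumBelow-cong n (e ∘ suc))

sumBelow-zero : ∀ {g} n → (∀ i → g i ≡ 0) → sumBelow g n ≡ 0
sumBelow-zero zero e = refl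
sumBelow-zero (suc n) e = cong₂ _+_ (e 0) (sumBelow-zero n (e ∘ suc))

sumBelow-+ : ∀ g h n → sumBelow (λ i → g i + h i) n ≡ sumBelow g n + sumBelow h n
sumBelow-+ g h zero = refl
sumBelow-+ g h (suc n) =
  trans (cong (g 0 + h 0 +_) (sumBelow-+ (g ∘ suc) (h ∘ suc) n)) (interchange (g 0) (h 0) _ _)

sumBelow-truncate : ∀ {g} a N → a ≤ N → (∀ i → a ≤ i → g i ≡ 0) → sumBelow g N ≡ sumBelow g a
sumBelow-truncate zero N _ e = sumBelow-zero N (λ i → e i z≤n)
sumBelow-truncate (suc a) (suc N) (s≤s a≤N) e =
  cong (_ +_) (sumBelow-truncate a N a≤N (λ i a≤i → e (suc i) (s≤s a≤i)))

ind : Bool → ℕ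
ind true = 1
ind false = 0

sumBelow-indicator : ∀ (h : ℕ → ℕ) c N → c < N → sumBelow (λ i → h i * ind (c ≡ᵇ i)) N ≡ h c
sumBelow-indicator h zero (suc N) _ =
  trans (cong₂ _+_ (*-identityʳ (h 0)) (sumBelow-zero N (λ i → *-zeroʳ (h (suc i))))) (+-identityʳ (h 0))
sumBelow-indicator h (suc c) (suc N) (s≤s c<N) =
  trans (cong (_+ sumBelow (λ i → h (suc i) * ind (c ≡ᵇ i)) N) (*-zeroʳ (h 0))) (sumBelow-indicator (h ∘ suc) c N c<N)

sumBelow-initial : ∀ a N → a ≤ N → sumBelow (λ i → ind (i <ᵇ a)) N ≡ a
sumBelow-initial zero N _ = sumBelow-zero N (λ _ → refl)
sumBelow-initial (suc a) (suc N) (s≤s a≤N) = cong suc (sumBelow-initial a N a≤N)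

sum-applyUpTo : ∀ (g f : ℕ → ℕ) n → sum (map g (applyUpTo f n)) ≡ sumBelow (g ∘ f) n
sum-applyUpTo g f zero = refl
sum-applyUpTo g f (suc n) = cong (g (f 0) +_) (sum-applyUpTo g (f ∘ suc) n)

sum-map-+ : ∀ (f g : A → ℕ) xs → sum (map (λ v → f v + g v) xs) ≡ sum (map f xs) + sum (map g xs)
sum-map-+ f g [] = refl
sum-map-+ f g (x ∷ xs) = trans (cong (f x + g x +_) (sum-map-+ f g xs)) (interchange (f x) (g x) _ _)

sum-map-one : ∀ (xs : List A) → sum (map (λ _ → 1) xs) ≡ length xs
sum-map-one [] = refl
sum-map-one (x ∷ xs) = cong suc (sum-map-one xs)

sum-map-suc : ∀ (f : A → ℕ) xs → sum (map (suc ∘ f) xs) ≡ sum (map f xs) + length xs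
sum-map-suc f xs = trans (sum-map-+ (λ _ → 1) f xs) (trans (+-comm (sum (map (λ _ → 1) xs)) _) (cong (sum (map f xs) +_) (sum-map-one xs)))

≤-sum : ∀ ns → All (_≤ sum ns) ns
≤-sum [] = []
≤-sum (n ∷ ns) = m≤m+n n _ ∷ All.map (λ le → ≤-trans le (m≤n+m _ n)) (≤-sum ns)

sum-lower-bound : ∀ (f : A → ℕ) r xs → All (λ v → r ≤ f v) xs → length xs * r ≤ sum (map f xs)
sum-lower-bound f r [] [] = z≤n
sum-lower-bound f r (x ∷ xs) (le ∷ les) = +-mono-≤ le (sum-lower-bound f r xs les)

sum-upper-bound : ∀ (f : A → ℕ) r xs → All (λ v → f v ≤ r) xs → sum (map f xs) ≤ length xs * r
sum-upper-bound f r [] [] = z≤n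
sum-upper-bound f r (x ∷ xs) (le ∷ les) = +-mono-≤ le (sum-upper-bound f r xs les)

sum-lower-bound-tight : ∀ (f : A → ℕ) r xs → All (λ v → r ≤ f v) xs →
  sum (map f xs) ≤ length xs * r → All (λ v → f v ≤ r) xs
sum-lower-bound-tight f r [] [] _ = []
sum-lower-bound-tight f r (x ∷ xs) (le ∷ les) total≤ = fx≤r ∷ sum-lower-bound-tight f r xs les rest≤
  where
  rest≤ : sum (map f xs) ≤ length xs * r
  rest≤ = +-cancelˡ-≤ r _ _ (≤-trans (+-monoˡ-≤ _ le) total≤)
  fx≤r : f x ≤ r
  fx≤r = +-cancelʳ-≤ _ _ _ (≤-trans (+-monoʳ-≤ (f x) (sum-lower-bound f r xs les)) total≤)

fibre : (A → ℕ) → List A → ℕ → ℕ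
fibre f xs i = length (filterᵇ (λ v → f v ≡ᵇ i) xs)

fibre-∷ : ∀ (f : A → ℕ) v xs i → fibre f (v ∷ xs) i ≡ ind (f v ≡ᵇ i) + fibre f xs i
fibre-∷ f v xs i with f v ≡ᵇ i
... | true = refl
... | false = refl

sum-by-fibres : ∀ (h : ℕ → ℕ) (f : A → ℕ) N xs → All (λ v → f v < N) xs →
  sum (map (h ∘ f) xs) ≡ sumBelow (λ i → h i * fibre f xs i) N
sum-by-fibres h f N [] [] = sym (sumBelow-zero N (λ i → *-zeroʳ (h i)))
sum-by-fibres h f N (v ∷ xs) (fv<N ∷ bounds) = begin
  h (f v) + sum (map (h ∘ f) xs)
    ≡⟨ cong₂ _+_ (sym (sumBelow-indicator h (f v) N fv<N)) (sum-by-fibres h f N xs bounds) ⟩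
  sumBelow (λ i → h i * ind (f v ≡ᵇ i)) N + sumBelow (λ i → h i * fibre f xs i) N
    ≡⟨ sym (sumBelow-+ _ _ N) ⟩
  sumBelow (λ i → h i * ind (f v ≡ᵇ i) + h i * fibre f xs i) N
    ≡⟨ sumBelow-cong N (λ i → trans (sym (*-distribˡ-+ (h i) _ _)) (cong (h i *_) (sym (fibre-∷ f v xs i)))) ⟩
  sumBelow (λ i → h i * fibre f (v ∷ xs) i) N ∎
  where open ≡-Reasoning

length-by-fibres : ∀ (f : A → ℕ) N xs → All (λ v → f v < N) xs → length xs ≡ sumBelow (fibre f xs) N
length-by-fibres f N xs bounds =
  trans (sym (sum-map-one xs))
    (trans (sum-by-fibres (λ _ → 1) f N xs bounds) (sumBelow-cong N (λ i → *-identityˡ _)))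

colLen-∷ : ∀ a l i → colLen (a ∷ l) i ≡ ind (i <ᵇ a) + colLen l i
colLen-∷ a l i with i <ᵇ a
... | true = refl
... | false = refl

colLen-vanish : ∀ l i → All (_≤ i) l → colLen l i ≡ 0
colLen-vanish [] i [] = refl
colLen-vanish (a ∷ l) i (a≤i ∷ l≤i) = trans (colLen-∷ a l i) (cong₂ _+_ (cong ind (<ᵇ-false a≤i)) (colLen-vanish l i l≤i))
  where
  <ᵇ-false : ∀ {i a} → a ≤ i → (i <ᵇ a) ≡ false
  <ᵇ-false {i} {a} a≤i with i <ᵇ a in eq
  ... | false = refl
  ... | true = ⊥-elim (<⇒≱ (<ᵇ⇒< i a (subst T (sym eq) _)) a≤i)

sumBelow-colLen : ∀ l N → All (_≤ N) l → sumBelow (colLen l) N ≡ sum l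
sumBelow-colLen [] N [] = sumBelow-zero N (λ _ → refl)
sumBelow-colLen (a ∷ l) N (a≤N ∷ l≤N) = begin
  sumBelow (colLen (a ∷ l)) N                      ≡⟨ sumBelow-cong N (colLen-∷ a l) ⟩
  sumBelow (λ i → ind (i <ᵇ a) + colLen l i) N     ≡⟨ sumBelow-+ _ _ N ⟩
  sumBelow (λ i → ind (i <ᵇ a)) N + sumBelow (colLen l) N
                                                   ≡⟨ cong₂ _+_ (sumBelow-initial a N a≤N) (sumBelow-colLen l N l≤N) ⟩
  a + sum l ∎
  where open ≡-Reasoning

parts≤ : ∀ l {N} → size l ≤ N → All (_≤ N) l
parts≤ l l≤N = All.map (λ a≤ → ≤-trans a≤ l≤N) (≤-sum l)

weightT-sumBelow : ∀ l N → size l ≤ N → weightT l ≡ sumBelow (λ i → i * colLen l i) N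
weightT-sumBelow l N l≤N = begin
  weightT l                                   ≡⟨ sum-applyUpTo (λ i → i * colLen l i) (λ i → i) (size l) ⟩
  sumBelow (λ i → i * colLen l i) (size l)    ≡⟨ sym (sumBelow-truncate (size l) N l≤N vanish) ⟩
  sumBelow (λ i → i * colLen l i) N ∎
  where
  open ≡-Reasoning
  vanish : ∀ i → size l ≤ i → i * colLen l i ≡ 0
  vanish i l≤i = trans (cong (i *_) (colLen-vanish l i (parts≤ l l≤i))) (*-zeroʳ i)

module FromColumns (f : A → ℕ) (l : List ℕ) (xs : List A) (columns : ∀ i → fibre f xs i ≡ colLen l i) where

  private
    N : ℕ
    N = suc (sum (map f xs)) + size l

    bounded : All (λ v → f v < N) xs
    bounded = All.map (λ le → s≤s (≤-trans le (m≤m+n _ (size l)))) (map⁻ (≤-sum (map f xs)))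

  length≡size : length xs ≡ size l
  length≡size = begin
    length xs                ≡⟨ length-by-fibres f N xs bounded ⟩
    sumBelow (fibre f xs) N  ≡⟨ sumBelow-cong N columns ⟩
    sumBelow (colLen l) N    ≡⟨ sumBelow-colLen l N (parts≤ l (m≤n+m _ _)) ⟩
    size l ∎
    where open ≡-Reasoning

  sum≡weightT : sum (map f xs) ≡ weightT l
  sum≡weightT = begin
    sum (map f xs)                            ≡⟨ sum-by-fibres (λ i → i) f N xs bounded ⟩
    sumBelow (λ i → i * fibre f xs i) N       ≡⟨ sumBelow-cong N (λ i → cong (i *_) (columns i)) ⟩
    sumBelow (λ i → i * colLen l i) N         ≡⟨ sym (weightT-sumBelow l N (m≤n+m _ _)) ⟩
    weightT l ∎
    where open ≡-Reasoning

deg : Pt → ℕ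
deg v = xc v + yc v + zc v

deg-sum-from-marginals : ∀ l m p P → HasMarginals P (colLen l) (colLen m) (colLen p) →
  sum (map deg P) ≡ weightT l + weightT m + weightT p
deg-sum-from-marginals l m p P (hx , hy , hz) = begin
  sum (map deg P)                                          ≡⟨ sum-map-+ (λ v → xc v + yc v) zc P ⟩
  sum (map (λ v → xc v + yc v) P) + sum (map zc P)         ≡⟨ cong (_+ sum (map zc P)) (sum-map-+ xc yc P) ⟩
  sum (map xc P) + sum (map yc P) + sum (map zc P)
    ≡⟨ cong₂ _+_ (cong₂ _+_ (FromColumns.sum≡weightT xc l P hx) (FromColumns.sum≡weightT yc m P hy))
                 (FromColumns.sum≡weightT zc p P hz) ⟩
  weightT l + weightT m + weightT p ∎
  where open ≡-Reasoning

cube : ℕ → List Pt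
cube s = cartesianProduct (upTo s) (cartesianProduct (upTo s) (upTo s))

simplexList≡ : ∀ s → simplexList s ≡ filterᵇ (λ v → deg v <ᵇ s) (cube s)
simplexList≡ s = cong (filterᵇ _) (trans (cong concat (map-cong rows (upTo s))) (concatMap-map _,_ (upTo s) _))
  where
  concatMap-map : ∀ {B C : Set} (g : A → B → C) xs ys →
    concatMap (λ x → map (g x) ys) xs ≡ cartesianProductWith g xs ys
  concatMap-map g [] ys = refl
  concatMap-map g (x ∷ xs) ys = cong (map (g x) ys ++_) (concatMap-map g xs ys)
  rows : ∀ x → concatMap (λ y → map (λ z → (x , y , z)) (upTo s)) (upTo s) ≡ map (x ,_) (cartesianProduct (upTo s) (upTo s))
  rows x = trans (concatMap-map (λ y z → (x , y , z)) (upTo s) (upTo s)) (row-map (upTo s))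
    where
    row-map : ∀ ys → cartesianProductWith (λ y z → (x , y , z)) ys (upTo s) ≡ map (x ,_) (cartesianProduct ys (upTo s))
    row-map [] = refl
    row-map (y ∷ ys) = trans (cong₂ _++_ (map-∘ (upTo s)) (row-map ys)) (sym (map-++ (x ,_) (map (y ,_) (upTo s)) _))

simplexList-unique : ∀ s → Unique (simplexList s)
simplexList-unique s rewrite simplexList≡ s =
  Unique.filter⁺ (T? ∘ (λ v → deg v <ᵇ s))
    (Unique.cartesianProduct⁺ (Unique.upTo⁺ s) (Unique.cartesianProduct⁺ (Unique.upTo⁺ s) (Unique.upTo⁺ s)))

simplexList⁺ : ∀ s v → InSimplex s v → v ∈ simplexList s
simplexList⁺ s (x , y , z) v∈P_s rewrite simplexList≡ s =
  ∈.∈-filter⁺ (T? ∘ (λ v → deg v <ᵇ s))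
    (∈.∈-cartesianProduct⁺ (∈.∈-upTo⁺ (≤-<-trans (≤-trans (m≤m+n x y) (m≤m+n _ z)) v∈P_s))
      (∈.∈-cartesianProduct⁺ (∈.∈-upTo⁺ (≤-<-trans (≤-trans (m≤n+m y x) (m≤m+n _ z)) v∈P_s))
                             (∈.∈-upTo⁺ (≤-<-trans (m≤n+m z _) v∈P_s))))
    (<⇒<ᵇ v∈P_s)

simplexList⁻ : ∀ s v → v ∈ simplexList s → InSimplex s v
simplexList⁻ s v v∈ rewrite simplexList≡ s =
  <ᵇ⇒< _ _ (proj₂ (∈.∈-filter⁻ (T? ∘ (λ v → deg v <ᵇ s)) {xs = cube s} v∈))

_≟ₚ_ : DecidableEquality Pt
_≟ₚ_ = Product.≡-dec _≟_ (Product.≡-dec _≟_ _≟_)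

open import Data.List.Membership.DecPropositional _≟ₚ_ using (_∈?_)

same-elements⇒↭ : ∀ {xs ys : List Pt} → Unique xs → Unique ys →
  (∀ {v} → v ∈ xs → v ∈ ys) → (∀ {v} → v ∈ ys → v ∈ xs) → xs ↭ ys
same-elements⇒↭ uxs uys to from = ∼bag⇒↭ (unique∧set⇒bag uxs uys (mk⇔ to from))

⊆⇒length≤ : ∀ {xs ys : List Pt} → Unique xs → Unique ys → (∀ {v} → v ∈ xs → v ∈ ys) → length xs ≤ length ys
⊆⇒length≤ {xs} {ys} uxs uys sub = ≤-trans (≤-reflexive (↭-length xs↭)) (length-filter (_∈? xs) ys)
  where
  xs↭ : xs ↭ filter (_∈? xs) ys
  xs↭ = same-elements⇒↭ uxs (Unique.filter⁺ (_∈? xs) uys)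
    (λ v∈xs → ∈.∈-filter⁺ (_∈? xs) (sub v∈xs) v∈xs)
    (λ v∈ → proj₂ (∈.∈-filter⁻ (_∈? xs) {xs = ys} v∈))

length<⇒missing : ∀ {xs ys : List Pt} → Unique xs → Unique ys → length ys < length xs → ∃ (λ v → v ∈ xs × v ∉ ys)
length<⇒missing {xs} {ys} uxs uys ys<xs with all? (_∈? ys) xs
... | yes all∈ = ⊥-elim (<⇒≱ ys<xs (⊆⇒length≤ uxs uys (All.lookup all∈)))
... | no ¬all∈ = find (¬All⇒Any¬ (_∈? ys) xs ¬all∈)

filter-split : ∀ {Q : A → Set} (Q? : ∀ v → Dec (Q v)) xs → xs ↭ filter Q? xs ++ filter (∁? Q?) xs
filter-split Q? [] = ↭-refl
filter-split Q? (x ∷ xs) with Q? x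
... | yes _ = prep x (filter-split Q? xs)
... | no _ = ↭-trans (prep x (filter-split Q? xs)) (↭-sym (shift x (filter Q? xs) _))

sum-split : ∀ {Q : A → Set} (Q? : ∀ v → Dec (Q v)) (f : A → ℕ) xs →
  sum (map f xs) ≡ sum (map f (filter Q? xs)) + sum (map f (filter (∁? Q?) xs))
sum-split Q? f xs =
  trans (sum-↭ (map⁺ f (filter-split Q? xs))) (trans (cong sum (map-++ f (filter Q? xs) _)) (sum-++ (map f (filter Q? xs)) _))

length-split : ∀ {Q : A → Set} (Q? : ∀ v → Dec (Q v)) xs →
  length xs ≡ length (filter Q? xs) + length (filter (∁? Q?) xs)
length-split Q? xs = trans (↭-length (filter-split Q? xs)) (length-++ (filter Q? xs))

-- The axis points (i,0,0), i < s, lie in P_s, so s ≤ |P_s|.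
s≤simplexSize : ∀ s → s ≤ simplexSize s
s≤simplexSize s = ≤-trans (≤-reflexive (sym (trans (length-map _ (upTo s)) (length-upTo s))))
  (⊆⇒length≤ (Unique.map⁺ (cong proj₁) (Unique.upTo⁺ s)) (simplexList-unique s) axis⊆)
  where
  axis⊆ : ∀ {v} → v ∈ map (λ i → (i , 0 , 0)) (upTo s) → v ∈ simplexList s
  axis⊆ v∈ with ∈.∈-map⁻ (λ i → (i , 0 , 0)) v∈
  ... | i , i∈ , refl = simplexList⁺ s (i , 0 , 0)
    (subst (_< s) (sym (trans (+-identityʳ (i + 0)) (+-identityʳ i))) (∈.∈-upTo⁻ i∈))

largest : ∀ (Q : ℕ → Set) → (∀ s → Dec (Q s)) → Q 0 → ∀ k → (∀ s → Q s → s ≤ k) →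
  ∃ (λ r → Q r × (∀ s → Q s → s ≤ r))
largest Q Q? Q0 zero bound = 0 , Q0 , bound
largest Q Q? Q0 (suc k) bound with Q? (suc k)
... | yes Qk = suc k , Qk , bound
... | no ¬Qk = largest Q Q? Q0 k (λ s Qs → below s (bound s Qs) (λ { refl → ¬Qk Qs }))
  where
  below : ∀ s → s ≤ suc k → s ≢ suc k → s ≤ k
  below s s≤ s≢ = ≤-pred (≤∧≢⇒< s≤ s≢)

largest-simplex : ∀ n → ∃ (IsLargestR n)
largest-simplex n =
  largest (λ s → simplexSize s ≤ n) (λ s → simplexSize s ≤? n) z≤n n (λ s le → ≤-trans (s≤simplexSize s) le)

-- The exchange argument

-- Arithmetic core.  b points of degree ≥ r replace c ≤ b points of degree < r,
-- the excess degree being r(b − c): then nothing was replaced and all b points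
-- have degree exactly r.  (β is their total degree, γ that of the replaced ones.)
exchange-arith : ∀ {r b c β γ} → c ≤ b → β ≡ γ + r * (b ∸ c) → b * r ≤ β → γ + c ≤ c * r →
  c ≡ 0 × β ≡ b * r
exchange-arith {r} {b} {c} {β} {γ} c≤b β≡ br≤β γ+c≤cr = c≡0 , β≡br
  where
  open ≤-Reasoning
  k : ℕ
  k = b ∸ c
  cr≤γ : c * r ≤ γ
  cr≤γ = +-cancelˡ-≤ (k * r) _ _ (begin
    k * r + c * r  ≡⟨ sym (*-distribʳ-+ r k c) ⟩
    (k + c) * r    ≡⟨ cong (_* r) (m∸n+n≡m c≤b) ⟩
    b * r          ≤⟨ br≤β ⟩
    β              ≡⟨ β≡ ⟩
    γ + r * k      ≡⟨ trans (+-comm γ _) (cong (_+ γ) (*-comm r k)) ⟩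
    k * r + γ      ∎)
  c≡0 : c ≡ 0
  c≡0 = n≤0⇒n≡0 (+-cancelˡ-≤ (c * r) c 0 (begin
    c * r + c      ≤⟨ +-monoˡ-≤ c cr≤γ ⟩
    γ + c          ≤⟨ γ+c≤cr ⟩
    c * r          ≡⟨ sym (+-identityʳ _) ⟩
    c * r + 0      ∎))
  γ≡0 : γ ≡ 0
  γ≡0 = n≤0⇒n≡0 (≤-trans (m≤m+n γ c) (≤-trans γ+c≤cr (≤-reflexive (cong (_* r) c≡0))))
  β≡br : β ≡ b * r
  β≡br = trans β≡ (trans (cong₂ (λ g c′ → g + r * (b ∸ c′)) γ≡0 c≡0) (*-comm r b))

below? : ∀ r v → Dec (deg v < r)
below? r v = deg v <? r

above : ℕ → FinSet → FinSet
above r P = filter (∁? (below? r)) P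

absent : ℕ → FinSet → FinSet
absent r P = filter (∁? (_∈? P)) (simplexList r)

overlap↭ : ∀ r P → Unique P → filter (below? r) P ↭ filter (_∈? P) (simplexList r)
overlap↭ r P uP = same-elements⇒↭ (Unique.filter⁺ (below? r) uP) (Unique.filter⁺ (_∈? P) (simplexList-unique r))
  (λ v∈ → let v∈P , low = ∈.∈-filter⁻ (below? r) {xs = P} v∈ in
          ∈.∈-filter⁺ (_∈? P) (simplexList⁺ r _ low) v∈P)
  (λ v∈ → let v∈L , v∈P = ∈.∈-filter⁻ (_∈? P) {xs = simplexList r} v∈ in
          ∈.∈-filter⁺ (below? r) v∈P (simplexList⁻ r _ v∈L))

above-high : ∀ r P → All (λ v → r ≤ deg v) (above r P)
above-high r P = All.map ≮⇒≥ (all-filter (∁? (below? r)) P)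

absent-low : ∀ r P → All (λ v → suc (deg v) ≤ r) (absent r P)
absent-low r P = All.tabulate (λ v∈ → simplexList⁻ r _ (proj₁ (∈.∈-filter⁻ (∁? (_∈? P)) {xs = simplexList r} v∈)))

exchange : ∀ r n P → Unique P → length P ≡ n → simplexSize r ≤ n → sum (map deg P) ≡ pVal n r →
  length (absent r P) ≡ 0 × sum (map deg (above r P)) ≡ length (above r P) * r
exchange r n P uP |P|≡n |P_r|≤n degP≡ =
  exchange-arith (+-cancelˡ-≤ α _ _ (subst₂ _≤_ |P_r|≡ n≡ |P_r|≤n)) degB≡
    (sum-lower-bound deg r B (above-high r P))
    (≤-trans (≤-reflexive (sym (sum-map-suc deg M))) (sum-upper-bound (suc ∘ deg) r M (absent-low r P)))
  where
  B M : FinSet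
  B = above r P
  M = absent r P
  shared : FinSet
  shared = filter (_∈? P) (simplexList r)
  a α : ℕ
  a = sum (map deg shared)
  α = length shared

  n≡ : n ≡ α + length B
  n≡ = trans (sym |P|≡n) (trans (length-split (below? r) P) (cong (_+ length B) (↭-length (overlap↭ r P uP))))
  |P_r|≡ : simplexSize r ≡ α + length M
  |P_r|≡ = length-split (_∈? P) (simplexList r)
  degB≡ : sum (map deg B) ≡ sum (map deg M) + r * (length B ∸ length M)
  degB≡ = +-cancelˡ-≡ a _ _ (begin
    a + sum (map deg B)    ≡⟨ cong (_+ sum (map deg B)) (sym (sum-↭ (map⁺ deg (overlap↭ r P uP)))) ⟩
    sum (map deg (filter (below? r) P)) + sum (map deg B)
                           ≡⟨ sym (sum-split (below? r) deg P) ⟩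
    sum (map deg P)        ≡⟨ degP≡ ⟩
    bDot r + r * (n ∸ simplexSize r)
      ≡⟨ cong₂ (λ t u → t + r * u) (sum-split (_∈? P) deg (simplexList r)) (cong₂ _∸_ n≡ |P_r|≡) ⟩
    a + sum (map deg M) + r * ((α + length B) ∸ (α + length M))
      ≡⟨ cong (λ u → a + sum (map deg M) + r * u) ([m+n]∸[m+o]≡n∸o α (length B) (length M)) ⟩
    a + sum (map deg M) + r * (length B ∸ length M)
      ≡⟨ +-assoc a (sum (map deg M)) _ ⟩
    a + (sum (map deg M) + r * (length B ∸ length M)) ∎)
    where open ≡-Reasoning

sandwich : ∀ r n P → Unique P → length P ≡ n → simplexSize r ≤ n → sum (map deg P) ≡ pVal n r →
  InSimplex r ⊆ₛ P × (∀ v → v ∈ P → InSimplex (suc r) v)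
sandwich r n P uP |P|≡n |P_r|≤n degP≡ = P_r⊆P , P⊆P_r+1
  where
  exchanged : length (absent r P) ≡ 0 × sum (map deg (above r P)) ≡ length (above r P) * r
  exchanged = exchange r n P uP |P|≡n |P_r|≤n degP≡

  P_r⊆P : InSimplex r ⊆ₛ P
  P_r⊆P v v∈P_r with v ∈? P
  ... | yes v∈P = v∈P
  ... | no v∉P = ⊥-elim (<⇒≢ (∈.∈-length (∈.∈-filter⁺ (∁? (_∈? P)) (simplexList⁺ r v v∈P_r) v∉P))
                             (sym (proj₁ exchanged)))

  P⊆P_r+1 : ∀ v → v ∈ P → InSimplex (suc r) v
  P⊆P_r+1 v v∈P with below? r v
  ... | yes low = m<n⇒m<1+n low
  ... | no high = s≤s (All.lookup
          (sum-lower-bound-tight deg r (above r P) (above-high r P) (≤-reflexive (proj₂ exchanged)))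
          (∈.∈-filter⁺ (∁? (below? r)) v∈P high))

lowered-same-degree : ∀ {x y z x′ y′ z′} → x′ ≤ x → y′ ≤ y → z′ ≤ z → x + y + z ≤ x′ + y′ + z′ →
  (x′ , y′ , z′) ≡ (x , y , z)
lowered-same-degree {x} {y} {z} {x′} {y′} {z′} x′≤x y′≤y z′≤z total≤ with
  ≤-antisym x′≤x (≮⇒≥ (λ x′<x → <⇒≱ (+-mono-<-≤ (+-mono-<-≤ x′<x y′≤y) z′≤z) total≤)) |
  ≤-antisym y′≤y (≮⇒≥ (λ y′<y → <⇒≱ (+-mono-<-≤ (+-mono-≤-< x′≤x y′<y) z′≤z) total≤)) |
  ≤-antisym z′≤z (≮⇒≥ (λ z′<z → <⇒≱ (+-mono-≤-< (+-mono-≤ x′≤x y′≤y) z′<z) total≤))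
... | refl | refl | refl = refl

sandwich⇒pyramid : ∀ r P → InSimplex r ⊆ₛ P → (∀ v → v ∈ P → InSimplex (suc r) v) → IsPyramid P
sandwich⇒pyramid r P P_r⊆P P⊆P_r+1 x y z x′ y′ z′ v∈P x′≤x y′≤y z′≤z with (x′ + y′ + z′) <? r
... | yes low = P_r⊆P _ low
... | no high = subst (_∈ P) (sym (lowered-same-degree x′≤x y′≤y z′≤z
                 (≤-trans (≤-pred (P⊆P_r+1 _ v∈P)) (≮⇒≥ high)))) v∈P

lemma3p1 : (l m p : List ℕ) → SimplexLike l m p →
    (P : FinSet) → Unique P → HasMarginals P (colLen l) (colLen m) (colLen p) →
    ∃ (λ r → 1 ≤ r × InSimplex r ⊆ₛ P × P ⊊ₛ InSimplex (suc r)) × IsPyramid P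
lemma3p1 l m p (_ , _ , _ , _ , _ , n≥1 , simplexLike) P uP marginals@(hx , _ , _) =
  (r , r≥1 , P_r⊆P , P⊆P_r+1 , missing) , sandwich⇒pyramid r P P_r⊆P P⊆P_r+1
  where
  n : ℕ
  n = size l
  |P|≡n : length P ≡ n
  |P|≡n = FromColumns.length≡size xc l P hx
  r : ℕ
  r = proj₁ (largest-simplex n)
  r-largest : IsLargestR n r
  r-largest = proj₂ (largest-simplex n)
  sandwiched : InSimplex r ⊆ₛ P × (∀ v → v ∈ P → InSimplex (suc r) v)
  sandwiched = sandwich r n P uP |P|≡n (proj₁ r-largest)
    (trans (deg-sum-from-marginals l m p P marginals) (simplexLike r r-largest))
  P_r⊆P : InSimplex r ⊆ₛ P
  P_r⊆P = proj₁ sandwiched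
  P⊆P_r+1 : ∀ v → v ∈ P → InSimplex (suc r) v
  P⊆P_r+1 = proj₂ sandwiched
  r≥1 : 1 ≤ r
  r≥1 = proj₂ r-largest 1 n≥1
  -- |P_{r+1}| > n = |P|, so some point of P_{r+1} is missing from P.
  missing : ∃ (λ v → InSimplex (suc r) v × v ∉ P)
  missing with length<⇒missing (simplexList-unique (suc r)) uP
                 (subst (_< simplexSize (suc r)) (sym |P|≡n) (≰⇒> (λ le → 1+n≰n (proj₂ r-largest (suc r) le))))
  ... | v , v∈ , v∉P = v , simplexList⁻ (suc r) v v∈ , v∉P
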